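{- Let $(G,\mathcal{B})$ be a biased graph. Every important subset $X \subseteq V(G)$ is the vertex set of an important balanced subgraph of $G$.
   Context: A biased graph is a pair $(G,\mathcal{B})$, $G$ an undirected graph and $\mathcal{B}$ a set of cycles (balanced cycles) such that in every theta subgraph, if two of its three cycles are balanced then so is the third. A subgraph is balanced if all its cycles are in $\mathcal{B}$. The cost of a subgraph $H$ is $|\delta_G(V(H))|+|E(G[V(H)])\setminus E(H)|$, where $\delta_G(X)$ is the set of edges with exactly one endpoint in $X$. A balanced subgraph $H'$ (strictly) dominates $H$ if $V(H)\subseteq V(H')$ and $\mathrm{cost}(H)\ge\mathrm{cost}(H')$ (with at least one strict); $H$ is important if no balanced subgraph strictly dominates it. A cleaning set for a graph is an edge set whose removal makes it balanced. The cost of $X\subseteq V(G)$ is $|\delta_G(X)|$ plus the minimum size of a cleaning set for $G[X]$. $X$ dominates $Y$ if $X\supseteq Y$ and $\mathrm{cost}(X)\le\mathrm{cost}(Y)$, strictly if at least one is strict; $X$ is an important subset if no vertex set strictly dominates it. -}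

module Defs where

open import Data.Nat as ℕ using (ℕ; suc; zero; _+_; _≤_; _<_)
open import Data.Fin using (Fin; zero; suc; toℕ; fromℕ; lower₁; inject₁; _≟_)
open import Data.Fin.Properties using (any?)
open import Data.Fin.Subset using (Subset; _⊆_; _∪_; _─_; ∣_∣)
open import Data.Bool using (Bool; T; _∧_; _xor_)
open import Data.Vec using (tabulate; lookup)
open import Data.Product using (Σ; _×_; _,_; proj₁; proj₂)
open import Data.Sum using (_⊎_)
open import Relation.Binary.PropositionalEquality using (_≡_; _≢_)
open import Relation.Nullary using (¬_; does)
open import Function.Definitions using (Injective)

-- Finite undirected multigraphs (loops and parallel edges allowed):
-- vertices Fin n, edges Fin m, each edge has an (unordered) pair of ends.

record Graph (n m : ℕ) : Set where
  field
    ends : Fin m → Fin n × Fin n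
open Graph public

cycSuc : ∀ {k} → Fin (suc k) → Fin (suc k)
cycSuc {k} i with k ℕ.≟ toℕ i
... | Relation.Nullary.yes _ = zero
... | Relation.Nullary.no ne = suc (lower₁ i ne)

module _ {n m : ℕ} (G : Graph n m) where

  Joins : Fin m → Fin n → Fin n → Set
  Joins e u v = ends G e ≡ (u , v) ⊎ ends G e ≡ (v , u)

  induced : Subset n → Subset m
  induced X = tabulate λ e → lookup X (proj₁ (ends G e)) ∧ lookup X (proj₂ (ends G e))

  boundary : Subset n → Subset m
  boundary X = tabulate λ e → lookup X (proj₁ (ends G e)) xor lookup X (proj₂ (ends G e))

  record Subgraph : Set where
    field
      verts  : Subset n
      edges  : Subset m
      closed : edges ⊆ induced verts
  open Subgraph public

  -- a cycle of length suc k: distinct vertices v₀ … v_k, distinct edges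
  -- e₀ … e_k with e_i joining v_i and v_{i+1 mod (k+1)}
  record Cycle : Set where
    field
      len  : ℕ
      vtx  : Fin (suc len) → Fin n
      edg  : Fin (suc len) → Fin m
      vinj : Injective _≡_ _≡_ vtx
      einj : Injective _≡_ _≡_ edg
      link : ∀ i → Joins (edg i) (vtx i) (vtx (cycSuc i))

  cycleEdges : Cycle → Subset m
  cycleEdges c = tabulate λ f → does (any? λ i → Cycle.edg c i ≟ f)

  IsCycle : Subset m → Set
  IsCycle C = Σ Cycle λ c → cycleEdges c ≡ C

  record Path : Set where
    field
      len  : ℕ
      vtx  : Fin (suc len) → Fin n
      edg  : Fin len → Fin m
      vinj : Injective _≡_ _≡_ vtx
      einj : Injective _≡_ _≡_ edg
      link : ∀ i → Joins (edg i) (vtx (inject₁ i)) (vtx (suc i))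

  pathEdges : Path → Subset m
  pathEdges p = tabulate λ f → does (any? λ i → Path.edg p i ≟ f)

  start end : Path → Fin n
  start p = Path.vtx p zero
  end p = Path.vtx p (fromℕ (Path.len p))

  InternallyDisjoint : Fin n → Fin n → Path → Path → Set
  InternallyDisjoint u v P Q =
    (∀ i j → Path.edg P i ≢ Path.edg Q j) ×
    (∀ i j → Path.vtx P i ≡ Path.vtx Q j → Path.vtx P i ≡ u ⊎ Path.vtx P i ≡ v)

  IsTheta : Fin n → Fin n → Path → Path → Path → Set
  IsTheta u v P Q R =
    u ≢ v ×
    (start P ≡ u × end P ≡ v) × (start Q ≡ u × end Q ≡ v) × (start R ≡ u × end R ≡ v) ×
    InternallyDisjoint u v P Q × InternallyDisjoint u v P R × InternallyDisjoint u v Q R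

record BiasedGraph (n m : ℕ) : Set where
  field
    graph    : Graph n m
    -- the set 𝓑 of balanced cycles (as a subset of the finite set of edge sets)
    balanced : Subset m → Bool
    cycles   : ∀ C → T (balanced C) → IsCycle graph C
    -- theta property (stated for all orderings of the three paths, hence
    -- "any two balanced ⇒ the third balanced")
    theta    : ∀ u v P Q R → IsTheta graph u v P Q R →
               T (balanced (pathEdges graph P ∪ pathEdges graph Q)) →
               T (balanced (pathEdges graph P ∪ pathEdges graph R)) →
               T (balanced (pathEdges graph Q ∪ pathEdges graph R))
open BiasedGraph public

module _ {n m : ℕ} (BG : BiasedGraph n m) where
  private G = graph BG

  BalancedEdges : Subset m → Set
  BalancedEdges E = ∀ C → IsCycle G C → C ⊆ E → T (balanced BG C)

  BalancedSub : Subgraph G → Set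
  BalancedSub H = BalancedEdges (edges H)

  costSub : Subgraph G → ℕ
  costSub H = ∣ boundary G (verts H) ∣ + ∣ induced G (verts H) ─ edges H ∣

  StrictlyDominatesSub : Subgraph G → Subgraph G → Set
  StrictlyDominatesSub H' H =
    BalancedSub H' × verts H ⊆ verts H' × costSub H ≥' costSub H' ×
    (verts H ≢ verts H' ⊎ costSub H' < costSub H)
    where
    _≥'_ : ℕ → ℕ → Set
    a ≥' b = b ≤ a

  ImportantSub : Subgraph G → Set
  ImportantSub H = ¬ Σ (Subgraph G) λ H' → StrictlyDominatesSub H' H

  Cleaning : Subset n → Subset m → Set
  Cleaning X S = S ⊆ induced G X × BalancedEdges (induced G X ─ S)

  MinCleaning : Subset n → ℕ → Set
  MinCleaning X k = Σ (Subset m) λ S → Cleaning X S × ∣ S ∣ ≡ k × (∀ S' → Cleaning X S' → k ≤ ∣ S' ∣)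

  CostSet : Subset n → ℕ → Set
  CostSet X c = Σ ℕ λ k → MinCleaning X k × c ≡ ∣ boundary G X ∣ + k

  StrictlyDominatesSet : Subset n → Subset n → Set
  StrictlyDominatesSet X Y =
    Y ⊆ X × Σ ℕ λ cX → Σ ℕ λ cY → CostSet X cX × CostSet Y cY × cX ≤ cY × (Y ≢ X ⊎ cX < cY)

  ImportantSet : Subset n → Set
  ImportantSet X = ¬ Σ (Subset n) λ X' → StrictlyDominatesSet X' X

-- Removing a cleaning set S from G[X] leaves a balanced subgraph of cost
-- |δ(X)| + |S|, and conversely the edges of G[V(H)] missing from a balanced
-- subgraph H form a cleaning set of V(H) of size cost(H) − |δ(V(H))|. So cost(X)
-- is the least cost of a balanced subgraph with vertex set X; removing a minimum
-- cleaning set attains it, and any subgraph strictly dominating the result would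
-- have a vertex set strictly dominating X. The minimum exists constructively
-- because balance is decidable: cycles are shorter than the number of vertices,
-- so they can be enumerated.
module Submission where

open import Defs
import Data.Bool as Bool
open import Data.Fin using (Fin; zero; suc; _≟_)
open import Data.Fin.Properties using (any?; all?; pigeonhole; <⇒≢)
open import Data.Fin.Subset using (Subset; _∈_; _∉_; _⊆_; _─_; ∣_∣; inside; outside)
open import Data.Fin.Subset.Properties
  using (_⊆?_; anySubset?; p─q⊆p; x∈p∧x∉q⇒x∈p─q; drop-there)
  renaming (_∈?_ to _∈ₛ?_)
open import Data.Nat as ℕ using (ℕ; _≤_; _<_; _<?_; _+_; s≤s)
open import Data.Nat.Induction using (<-wellFounded)
open import Data.Nat.Properties using (≤-trans; ≤-<-trans; ≮⇒≥; +-monoʳ-≤; anyUpTo?)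
import Data.Product.Properties as Product
open import Data.Product using (Σ; ∃; _×_; _,_; proj₁; proj₂)
open import Data.Sum using (map₂)
open import Data.Vec using ([]; _∷_; here; there; tabulate)
open import Data.Vec.Functional using (head; tail) renaming (_∷_ to _◂_)
open import Data.Vec.Properties using (tabulate-cong; lookup∘tabulate; lookup⇒[]=)
  renaming (≡-dec to ≡-decVec)
open import Function using (_∘_; mk⇔)
open import Function.Definitions using (Injective)
open import Induction.WellFounded using (Acc; acc)
open import Relation.Binary.PropositionalEquality
  using (_≡_; _≗_; refl; sym; trans; cong; subst; subst₂)
open import Relation.Nullary using (Dec; yes; no; ¬?; does; contradiction)
open import Relation.Nullary.Decidable
  using (map′; _×-dec_; _⊎-dec_; _→-dec_; T?; decidable-stable; does-⇔; dec-true)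
open import Level using (0ℓ)
open import Relation.Unary using (Pred; Decidable)

Searchable : Set → Set₁
Searchable A = ∀ {P : Pred A 0ℓ} → Decidable P → Dec (∃ P)

anyFunction? : ∀ {A : Set} → Searchable A → ∀ k {P : Pred (Fin k → A) 0ℓ} →
               (∀ {f g} → f ≗ g → P f → P g) → Decidable P → Dec (∃ P)
anyFunction? any?A ℕ.zero resp P? =
  map′ (λ p → empty , p) (λ (f , p) → resp (λ ()) p) (P? empty)
  where
  empty : Fin ℕ.zero → _
  empty ()
anyFunction? any?A (ℕ.suc k) {P} resp P? =
  map′ (λ (a , g , p) → a ◂ g , p) (λ (f , p) → head f , tail f , resp η p)
       (any?A λ a → anyFunction? any?A k (resp ∘ ◂-cong) (P? ∘ (a ◂_)))
  where
  ◂-cong : ∀ {a} {g g′ : Fin k → _} → g ≗ g′ → (a ◂ g) ≗ (a ◂ g′)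
  ◂-cong eq zero    = refl
  ◂-cong eq (suc i) = eq i
  η : ∀ {f} → f ≗ (head f ◂ tail f)
  η zero    = refl
  η (suc i) = refl

allSubset? : ∀ {k} {P : Pred (Subset k) 0ℓ} → Decidable P → Dec (∀ S → P S)
allSubset? P? with anySubset? (¬? ∘ P?)
... | yes (S , ¬PS) = no λ ∀P → ¬PS (∀P S)
... | no ¬∃¬P      = yes λ S → decidable-stable (P? S) (λ ¬PS → ¬∃¬P (S , ¬PS))

module _ {k} {P : Pred (Subset k) 0ℓ} (P? : Decidable P) (μ : Subset k → ℕ) where

  minimiser : ∀ S → P S → ∃ λ S* → P S* × (∀ T → P T → μ S* ≤ μ T)
  minimiser S PS = descend S PS (<-wellFounded (μ S))
    where
    descend : ∀ S → P S → Acc _<_ (μ S) → ∃ λ S* → P S* × (∀ T → P T → μ S* ≤ μ T)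
    descend S PS (acc rs) with anySubset? (λ T → P? T ×-dec (μ T <? μ S))
    ... | yes (T , PT , T<S) = descend T PT (rs T<S)
    ... | no ¬smaller        = S , PS , λ T PT → ≮⇒≥ λ T<S → ¬smaller (T , PT , T<S)

x∈p─q⇒x∉q : ∀ {k} {x : Fin k} (p q : Subset k) → x ∈ p ─ q → x ∉ q
x∈p─q⇒x∉q (inside ∷ p)  (outside ∷ q) here ()
x∈p─q⇒x∉q (_ ∷ p)       (_ ∷ q)       (there x∈) (there x∈q) =
  x∈p─q⇒x∉q p q x∈ x∈q

p─[p─q]≡q : ∀ {k} (p q : Subset k) → q ⊆ p → p ─ (p ─ q) ≡ q
p─[p─q]≡q []            []            q⊆p = refl
p─[p─q]≡q (inside ∷ p)  (inside ∷ q)  q⊆p = cong (inside ∷_) (p─[p─q]≡q p q (drop-there ∘ q⊆p ∘ there))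
p─[p─q]≡q (inside ∷ p)  (outside ∷ q) q⊆p = cong (outside ∷_) (p─[p─q]≡q p q (drop-there ∘ q⊆p ∘ there))
p─[p─q]≡q (outside ∷ p) (outside ∷ q) q⊆p = cong (outside ∷_) (p─[p─q]≡q p q (drop-there ∘ q⊆p ∘ there))
p─[p─q]≡q (outside ∷ p) (inside ∷ q)  q⊆p with q⊆p here
... | ()

injective-cong : ∀ {A B : Set} {f g : A → B} → f ≗ g → Injective _≡_ _≡_ f → Injective _≡_ _≡_ g
injective-cong f≗g f-inj {x} {y} gx≡gy = f-inj (trans (f≗g x) (trans gx≡gy (sym (f≗g y))))

injective? : ∀ {k l} (f : Fin k → Fin l) → Dec (Injective _≡_ _≡_ f)
injective? f = map′ (λ inj → inj _ _) (λ inj _ _ → inj)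
  (all? λ x → all? λ y → (f x ≟ f y) →-dec (x ≟ y))

module _ {n m : ℕ} (G : Graph n m) where

  joins? : ∀ e u v → Dec (Joins G e u v)
  joins? e u v = Product.≡-dec _≟_ _≟_ (ends G e) (u , v) ⊎-dec Product.≡-dec _≟_ _≟_ (ends G e) (v , u)

  edgeSet : ∀ {k} → (Fin k → Fin m) → Subset m
  edgeSet e = tabulate λ f → does (any? λ i → e i ≟ f)

  edgeSet-cong : ∀ {k} {e e′ : Fin k → Fin m} → e ≗ e′ → edgeSet e ≡ edgeSet e′
  edgeSet-cong {e = e} {e′} e≗e′ = tabulate-cong λ f → does-⇔
    (mk⇔ (λ (i , eq) → i , trans (sym (e≗e′ i)) eq) (λ (i , eq) → i , trans (e≗e′ i) eq))
    (any? λ i → e i ≟ f) (any? λ i → e′ i ≟ f)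

  CycleAlong : (C : Subset m) → ∀ k → (Fin (ℕ.suc k) → Fin n) → (Fin (ℕ.suc k) → Fin m) → Set
  CycleAlong C k v e =
    Injective _≡_ _≡_ v × Injective _≡_ _≡_ e ×
    (∀ i → Joins G (e i) (v i) (v (cycSuc i))) × edgeSet e ≡ C

  cycleAlong? : ∀ C k v e → Dec (CycleAlong C k v e)
  cycleAlong? C k v e =
    injective? v ×-dec injective? e ×-dec
    all? (λ i → joins? (e i) (v i) (v (cycSuc i))) ×-dec
    ≡-decVec Bool._≟_ (edgeSet e) C

  cycleAlong-cong : ∀ {C k v v′ e e′} → v ≗ v′ → e ≗ e′ →
                      CycleAlong C k v e → CycleAlong C k v′ e′
  cycleAlong-cong v≗v′ e≗e′ (v-inj , e-inj , link , e≡C) =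
    injective-cong v≗v′ v-inj , injective-cong e≗e′ e-inj ,
    (λ i → subst (λ f → Joins G f _ _) (e≗e′ i)
             (subst₂ (Joins G _) (v≗v′ i) (v≗v′ (cycSuc i)) (link i))) ,
    trans (sym (edgeSet-cong e≗e′)) e≡C

  cycle-len< : (c : Cycle G) → Cycle.len c < n
  cycle-len< c with Cycle.len c <? n
  ... | yes len<n = len<n
  ... | no len≮n with pigeonhole (s≤s (≮⇒≥ len≮n)) (Cycle.vtx c)
  ...   | i , j , i<j , vi≡vj = contradiction (Cycle.vinj c vi≡vj) (<⇒≢ i<j)

  isCycle? : ∀ C → Dec (IsCycle G C)
  isCycle? C = map′ toCycle fromCycle
    (anyUpTo? (λ k → anyFunction? any? (ℕ.suc k) respV λ v →
                       anyFunction? any? (ℕ.suc k) (cycleAlong-cong (λ _ → refl)) λ e →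
                       cycleAlong? C k v e) n)
    where
    ShortCycleAlong : Set
    ShortCycleAlong = ∃ λ k → k < n × ∃ λ v → ∃ (CycleAlong C k v)
    respV : ∀ {k v v′} → v ≗ v′ → ∃ (CycleAlong C k v) → ∃ (CycleAlong C k v′)
    respV v≗v′ (e , w) = e , cycleAlong-cong v≗v′ (λ _ → refl) w
    toCycle : ShortCycleAlong → IsCycle G C
    toCycle (k , _ , v , e , v-inj , e-inj , link , e≡C) =
      record { len = k ; vtx = v ; edg = e ; vinj = v-inj ; einj = e-inj ; link = link } , e≡C
    fromCycle : IsCycle G C → ShortCycleAlong
    fromCycle (c , e≡C) = len , cycle-len< c , vtx , edg , (λ {_ _} → vinj) , (λ {_ _} → einj) , link , e≡C
      where open Cycle c

  cycle-nonempty : (c : Cycle G) → Cycle.edg c zero ∈ cycleEdges G c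
  cycle-nonempty c = lookup⇒[]= e₀ (cycleEdges G c)
    (trans (lookup∘tabulate _ e₀) (dec-true (any? λ i → Cycle.edg c i ≟ e₀) (zero , refl)))
    where e₀ = Cycle.edg c zero

module _ {n m : ℕ} (BG : BiasedGraph n m) where
  private G = graph BG

  balancedEdges? : Decidable (BalancedEdges BG)
  balancedEdges? E = allSubset? λ C → isCycle? G C →-dec (C ⊆? E →-dec T? (balanced BG C))

  cleaning? : ∀ X → Decidable (Cleaning BG X)
  cleaning? X S = S ⊆? induced G X ×-dec balancedEdges? (induced G X ─ S)

  induced-cleaning : ∀ X → Cleaning BG X (induced G X)
  induced-cleaning X = (λ e∈ → e∈) , λ C (c , c≡C) C⊆∅ →
    let e∈ = C⊆∅ (subst (_ ∈_) c≡C (cycle-nonempty G c))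
    in contradiction (p─q⊆p (induced G X) _ e∈) (x∈p─q⇒x∉q _ _ e∈)

  minimumCleaning : ∀ X → ∃ λ S → Cleaning BG X S × (∀ S′ → Cleaning BG X S′ → ∣ S ∣ ≤ ∣ S′ ∣)
  minimumCleaning X = minimiser (cleaning? X) ∣_∣ (induced G X) (induced-cleaning X)

  cost : Subset n → ℕ
  cost X = ∣ boundary G X ∣ + ∣ proj₁ (minimumCleaning X) ∣

  costSet : ∀ X → CostSet BG X (cost X)
  costSet X = let (S , cl , min) = minimumCleaning X in ∣ S ∣ , (S , cl , refl , min) , refl

  cleanedSubgraph : ∀ X S → Subgraph G
  cleanedSubgraph X S = record { verts = X ; edges = induced G X ─ S ; closed = p─q⊆p _ S }

  costSub-cleanedSubgraph : ∀ X S → S ⊆ induced G X →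
                            costSub BG (cleanedSubgraph X S) ≡ ∣ boundary G X ∣ + ∣ S ∣
  costSub-cleanedSubgraph X S S⊆ =
    cong (λ T → ∣ boundary G X ∣ + ∣ T ∣) (p─[p─q]≡q (induced G X) S S⊆)

  missingEdges-cleaning : ∀ H → BalancedSub BG H → Cleaning BG (verts H) (induced G (verts H) ─ edges H)
  missingEdges-cleaning H balH = p─q⊆p _ _ , λ C cyc C⊆ → balH C cyc (λ e∈C → present (C⊆ e∈C))
    where
    present : ∀ {e} → e ∈ induced G (verts H) ─ (induced G (verts H) ─ edges H) → e ∈ edges H
    present {e} e∈ with e ∈ₛ? edges H
    ... | yes e∈H = e∈H
    ... | no  e∉H = contradiction (x∈p∧x∉q⇒x∈p─q (p─q⊆p _ _ e∈) e∉H) (x∈p─q⇒x∉q _ _ e∈)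

  cost≤costSub : ∀ H → BalancedSub BG H → cost (verts H) ≤ costSub BG H
  cost≤costSub H balH =
    +-monoʳ-≤ ∣ boundary G (verts H) ∣ (proj₂ (proj₂ (minimumCleaning (verts H))) _ (missingEdges-cleaning H balH))

  optimalSubgraph : Subset n → Subgraph G
  optimalSubgraph X = cleanedSubgraph X (proj₁ (minimumCleaning X))

  optimalSubgraph-balanced : ∀ X → BalancedSub BG (optimalSubgraph X)
  optimalSubgraph-balanced X = proj₂ (proj₁ (proj₂ (minimumCleaning X)))

  costSub-optimalSubgraph : ∀ X → costSub BG (optimalSubgraph X) ≡ cost X
  costSub-optimalSubgraph X =
    costSub-cleanedSubgraph X _ (proj₁ (proj₁ (proj₂ (minimumCleaning X))))

  strictlyDominatesSub⇒strictlyDominatesSet : ∀ {H H′} → costSub BG H ≡ cost (verts H) →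
    StrictlyDominatesSub BG H′ H → StrictlyDominatesSet BG (verts H′) (verts H)
  strictlyDominatesSub⇒strictlyDominatesSet {H} {H′} costH (balH′ , V⊆V′ , H′≤H , strict) =
    V⊆V′ , _ , _ , costSet (verts H′) , costSet (verts H) ,
    ≤-trans cost′≤ (subst (costSub BG H′ ≤_) costH H′≤H) ,
    map₂ (λ H′<H → ≤-<-trans cost′≤ (subst (costSub BG H′ <_) costH H′<H)) strict
    where
    cost′≤ : cost (verts H′) ≤ costSub BG H′
    cost′≤ = cost≤costSub H′ balH′

  importantSet⇒importantSub : ∀ H → costSub BG H ≡ cost (verts H) →
                              ImportantSet BG (verts H) → ImportantSub BG H
  importantSet⇒importantSub H costH importantV (H′ , H′≻H) =
    importantV (verts H′ , strictlyDominatesSub⇒strictlyDominatesSet {H} {H′} costH H′≻H)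

proposition10 : ∀ {n m : ℕ} (BG : BiasedGraph n m) (X : Subset n) → ImportantSet BG X →
    Σ (Subgraph (graph BG)) λ H →
    verts H ≡ X × BalancedSub BG H × ImportantSub BG H
proposition10 BG X importantX =
  optimalSubgraph BG X , refl , optimalSubgraph-balanced BG X ,
  importantSet⇒importantSub BG (optimalSubgraph BG X) (costSub-optimalSubgraph BG X) importantX
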